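{- In infinite Mastermind with words of length $\omega$ and at least two colors, whether or not duplication of colors within a word is allowed, there is no strategy for the codebreaker ensuring that she wins at some finite stage of play.
   Context: Infinite Mastermind: a set $\Sigma$ of colors ($|\Sigma|\ge 2$); codewords and guesswords are elements of ${}^\omega\Sigma$ (in the no-duplication variant, injective elements). A hidden codeword $w$ is fixed; the codebreaker places guesswords, each chosen as a function of the feedback to earlier guesses, and wins when a guess equals $w$. The feedback on guess $s$ is a triple of cardinals $(\kappa,\rho,\varepsilon)$: $\kappa=|C|$ where $C=\{n\mid s(n)=w(n)\}$; for a permutation of the positions $\omega\setminus C$ rearranging the incorrect pegs of $s$ that simultaneously maximizes the number of newly correct positions and minimizes the number of remaining incorrect ones, $\rho$ is the number of newly correct positions and $\varepsilon$ the number remaining incorrect. -}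

module Defs where

open import Data.Nat using (ℕ; _≤_)
open import Data.Fin using (Fin)
open import Data.Product using (Σ; ∃; _×_; _,_)
open import Data.List using (List; []; _∷_)
open import Data.Unit using (⊤)
open import Relation.Binary.PropositionalEquality using (_≡_; _≢_)

Word : Set → Set
Word C = ℕ → C

InjectiveWord : {C : Set} → Word C → Set
InjectiveWord w = ∀ m n → w m ≡ w n → m ≡ n

data Variant : Set where
  withDuplication    : Variant
  withoutDuplication : Variant

Admissible : {C : Set} → Variant → Word C → Set
Admissible withDuplication    w = ⊤
Admissible withoutDuplication w = InjectiveWord w

-- Cardinals ≤ ω (all cardinalities of subsets of ω).
data Card : Set where
  fin : ℕ → Card
  ω   : Card

data _≤c_ : Card → Card → Set where
  fin≤fin : ∀ {m n} → m ≤ n → fin m ≤c fin n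
  fin≤ω   : ∀ {m} → fin m ≤c ω
  ω≤ω     : ω ≤c ω

HasCard : (ℕ → Set) → Card → Set
HasCard P (fin k) =
  Σ (Fin k → ℕ) λ f →
    (∀ i j → f i ≡ f j → i ≡ j) × (∀ i → P (f i)) × (∀ x → P x → ∃ λ i → f i ≡ x)
HasCard P ω =
  Σ (ℕ → ℕ) λ f → (∀ i j → f i ≡ f j → i ≡ j) × (∀ i → P (f i))

PermOn : (ℕ → Set) → (ℕ → ℕ) → Set
PermOn D π =
  (∀ n → D n → D (π n)) ×
  (∀ m n → D m → D n → π m ≡ π n → m ≡ n) ×
  (∀ m → D m → ∃ λ n → D n × π n ≡ m)

module _ {C : Set} (s w : Word C) where
  Correct : ℕ → Set
  Correct n = s n ≡ w n

  Incorrect : ℕ → Set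
  Incorrect n = s n ≢ w n

  -- after rearranging incorrect pegs via π (new peg at n is s (π n)):
  NewlyCorrect : (ℕ → ℕ) → ℕ → Set
  NewlyCorrect π n = Incorrect n × s (π n) ≡ w n

  RemainingIncorrect : (ℕ → ℕ) → ℕ → Set
  RemainingIncorrect π n = Incorrect n × s (π n) ≢ w n

Feedback : Set
Feedback = Card × Card × Card

IsFeedback : {C : Set} → Word C → Word C → Feedback → Set
IsFeedback s w (κ , ρ , ε) =
  HasCard (Correct s w) κ ×
  (∃ λ π → PermOn (Incorrect s w) π ×
           HasCard (NewlyCorrect s w π) ρ ×
           HasCard (RemainingIncorrect s w π) ε ×
           (∀ π' c → PermOn (Incorrect s w) π' →
              HasCard (NewlyCorrect s w π') c → c ≤c ρ) ×
           (∀ π' c → PermOn (Incorrect s w) π' →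
              HasCard (RemainingIncorrect s w π') c → ε ≤c c))

-- A strategy: the next guess as a function of the feedback received so far
-- (history listed most recent first; the first guess is σ []).
Strategy : Set → Set
Strategy C = List Feedback → Word C

data Reachable {C : Set} (σ : Strategy C) (w : Word C) : List Feedback → Set where
  start : Reachable σ w []
  step  : ∀ {h f} → Reachable σ w h → IsFeedback (σ h) w f → Reachable σ w (f ∷ h)

WinsAgainst : {C : Set} → Strategy C → Word C → Set
WinsAgainst σ w = ∃ λ h → Reachable σ w h × (∀ n → σ h n ≡ w n)

-- A strategy makes only countably many guesses σ h, one per feedback history.  For
-- each β : ℕ → Bool we build an admissible codeword w β from which β can be decoded
-- out of any guess equal to it; diagonalising against an enumeration of the
-- histories gives a codeword that is never guessed.
--
-- With duplication, w β n is a or b according to β n; comparing colours with a is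
-- decidable since a winning strategy injects colours into histories via the
-- constant codewords.  Without duplication, w β = g ∘ τ β, where g is the first
-- guess and τ β rotates each block {3i, 3i+1, 3i+2} in direction β i.  Against the
-- codeword w β the rearrangement τ β of g leaves no peg incorrect, so the optimal
-- rearrangement reported by the feedback on g must be τ β itself; hence β can be
-- read off the winning play against w β.
module Submission where

open import Defs
open import Data.Product using (∃)
open import Relation.Binary.PropositionalEquality using (_≢_)
open import Relation.Nullary using (¬_)

open import Data.Bool using (Bool; true; false; if_then_else_; not)
open import Data.Bool.Properties using (not-¬; not-involutive)
open import Data.Empty using (⊥-elim)
open import Data.List using (List; []; _∷_; length)
import Data.List.Properties as List
open import Data.Nat using (ℕ; zero; suc; _+_; _≡ᵇ_; z≤n)
open import Data.Nat.Properties using (_≟_; +-suc; +-identityʳ; suc-injective)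
open import Data.Product using (Σ; _×_; _,_; proj₁; proj₂; uncurry; map)
import Data.Product.Properties as Product
open import Data.Unit using (tt)
open import Function using (id; _∘_)
open import Function.Bundles using (mk↣)
open import Relation.Binary.Definitions using (DecidableEquality)
open import Relation.Binary.PropositionalEquality using (_≡_; refl; sym; trans; cong; module ≡-Reasoning)
open import Relation.Nullary.Decidable using (yes; no; does; map′; via-injection; dec-true; dec-false; decidable-stable)

Enumeration : Set → Set
Enumeration A = Σ (ℕ → A) λ e → ∀ a → ∃ λ n → e n ≡ a

-- Cantor's zig-zag: the diagonal x + y = d is traversed from (0 , d) to (d , 0).
zigzag : ℕ × ℕ → ℕ × ℕ
zigzag (x , suc y) = suc x , y
zigzag (x , zero)  = 0 , suc x

unpair : ℕ → ℕ × ℕ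
unpair zero    = 0 , 0
unpair (suc n) = zigzag (unpair n)

unpair-surjective : ∀ p → ∃ λ n → unpair n ≡ p
unpair-surjective (x , y) = onDiagonal (x + y) x y refl
  where
  onDiagonal : ∀ d x y → x + y ≡ d → ∃ λ n → unpair n ≡ (x , y)
  onDiagonal d       zero    zero    _  = 0 , refl
  onDiagonal d       (suc x) y       eq with onDiagonal d x (suc y) (trans (+-suc x y) eq)
  ... | n , p = suc n , cong zigzag p
  onDiagonal zero    zero    (suc y) ()
  onDiagonal (suc d) zero    (suc y) eq with onDiagonal d y 0 (trans (+-identityʳ y) (suc-injective eq))
  ... | n , p = suc n , cong zigzag p

enumeration-× : ∀ {A B} → Enumeration A → Enumeration B → Enumeration (A × B)
enumeration-× (eA , eA-onto) (eB , eB-onto) = e , e-onto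
  where
  e : ℕ → _
  e = map eA eB ∘ unpair
  e-onto : ∀ ab → ∃ λ n → e n ≡ ab
  e-onto (a , b) with eA-onto a | eB-onto b
  ... | i , refl | j , refl with unpair-surjective (i , j)
  ... | n , p = n , cong (map eA eB) p

enumeration-List : ∀ {A} → Enumeration A → Enumeration (List A)
enumeration-List {A} (eA , eA-onto) = e , e-onto
  where
  ofLength : ℕ → ℕ → List A
  ofLength zero    r = []
  ofLength (suc l) r = eA (proj₁ (unpair r)) ∷ ofLength l (proj₂ (unpair r))
  ofLength-onto : ∀ xs → ∃ λ r → ofLength (length xs) r ≡ xs
  ofLength-onto []       = 0 , refl
  ofLength-onto (x ∷ xs) with eA-onto x | ofLength-onto xs
  ... | i , refl | j , q with unpair-surjective (i , j)
  ... | n , refl = n , cong (eA i ∷_) q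
  e : ℕ → List A
  e = uncurry ofLength ∘ unpair
  e-onto : ∀ xs → ∃ λ n → e n ≡ xs
  e-onto xs with ofLength-onto xs
  ... | j , q with unpair-surjective (length xs , j)
  ... | n , p = n , trans (cong (uncurry ofLength) p) q

enumeration-Card : Enumeration Card
enumeration-Card = e , e-onto
  where
  e : ℕ → Card
  e zero    = ω
  e (suc k) = fin k
  e-onto : ∀ c → ∃ λ n → e n ≡ c
  e-onto (fin k) = suc k , refl
  e-onto ω       = 0 , refl

enumeration-History : Enumeration (List Feedback)
enumeration-History =
  enumeration-List (enumeration-× enumeration-Card (enumeration-× enumeration-Card enumeration-Card))

diagonal-escapes : ∀ {H : Set} → Enumeration H → (read : H → ℕ → Bool) →
                   ∃ λ β → ∀ h → ¬ (∀ i → read h i ≡ β i)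
diagonal-escapes (e , e-onto) read = (λ i → not (read (e i) i)) , escapes
  where
  escapes : ∀ h → ¬ (∀ i → read h i ≡ not (read (e i) i))
  escapes h agrees with e-onto h
  ... | j , refl = not-¬ refl (agrees j)

_≟ᶜ_ : DecidableEquality Card
fin m ≟ᶜ fin n = map′ (cong fin) fin-injective (m ≟ n)
  where
  fin-injective : fin m ≡ fin n → m ≡ n
  fin-injective refl = refl
fin _ ≟ᶜ ω     = no λ ()
ω     ≟ᶜ fin _ = no λ ()
ω     ≟ᶜ ω     = yes refl

_≟ʰ_ : DecidableEquality (List Feedback)
_≟ʰ_ = List.≡-dec (Product.≡-dec _≟ᶜ_ (Product.≡-dec _≟ᶜ_ _≟ᶜ_))

record BitCoding {C : Set} (v : Variant) (σ : Strategy C) : Set where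
  field
    codeword     : (ℕ → Bool) → Word C
    admissible   : ∀ β → Admissible v (codeword β)
    decode       : List Feedback → ℕ → Bool
    decode-guess : ∀ h β → (∀ n → σ h n ≡ codeword β n) → ∀ i → decode h i ≡ β i

  notWinning : ¬ (∀ w → Admissible v w → WinsAgainst σ w)
  notWinning wins with diagonal-escapes enumeration-History decode
  ... | β , escapes with wins (codeword β) (admissible β)
  ... | h , _ , guessed = escapes h (decode-guess h β guessed)

module _ {C : Set} (σ : Strategy C) where

  decidableColours : (∀ c → WinsAgainst σ (λ _ → c)) → DecidableEquality C
  decidableColours wins = via-injection (mk↣ winningHistory-injective) _≟ʰ_
    where
    winningHistory : C → List Feedback
    winningHistory c = proj₁ (wins c)
    winningHistory-injective : ∀ {c d} → winningHistory c ≡ winningHistory d → c ≡ d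
    winningHistory-injective {c} {d} eq = begin
      c                        ≡⟨ proj₂ (proj₂ (wins c)) 0 ⟨
      σ (winningHistory c) 0   ≡⟨ cong (λ h → σ h 0) eq ⟩
      σ (winningHistory d) 0   ≡⟨ proj₂ (proj₂ (wins d)) 0 ⟩
      d                        ∎
      where open ≡-Reasoning

  duplicationCoding : {a b : C} → a ≢ b → DecidableEquality C → BitCoding withDuplication σ
  duplicationCoding {a} {b} a≢b _≟C_ = record
    { codeword     = λ β n → if β n then a else b
    ; admissible   = λ _ → tt
    ; decode       = λ h n → does (σ h n ≟C a)
    ; decode-guess = λ h β guessed i → decode-colour (β i) (guessed i)
    }
    where
    decode-colour : ∀ x {c} → c ≡ (if x then a else b) → does (c ≟C a) ≡ x
    decode-colour true  refl = dec-true (a ≟C a) refl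
    decode-colour false refl = dec-false (b ≟C a) (a≢b ∘ sym)

record Derangement (τ : ℕ → ℕ) : Set where
  field
    injective    : ∀ m n → τ m ≡ τ n → m ≡ n
    surjective   : ∀ m → ∃ λ n → τ n ≡ m
    fixpointFree : ∀ n → τ n ≢ n

rotate : (ℕ → Bool) → ℕ → ℕ
rotate β 0 = if β 0 then 1 else 2
rotate β 1 = if β 0 then 2 else 0
rotate β 2 = if β 0 then 0 else 1
rotate β (suc (suc (suc n))) = 3 + rotate (β ∘ suc) n

blockStart : ℕ → ℕ
blockStart zero    = 0
blockStart (suc i) = 3 + blockStart i

rotate-bit : ∀ β i → (rotate β (blockStart i) ≡ᵇ suc (blockStart i)) ≡ β i
rotate-bit β zero with β 0
... | true  = refl
... | false = refl
rotate-bit β (suc i) = rotate-bit (β ∘ suc) i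

rotate-inverse : ∀ β γ → (∀ i → γ i ≡ not (β i)) → ∀ n → rotate γ (rotate β n) ≡ n
rotate-inverse β γ opp 0 with β 0 | opp 0
... | true  | γ0 rewrite γ0 = refl
... | false | γ0 rewrite γ0 = refl
rotate-inverse β γ opp 1 with β 0 | opp 0
... | true  | γ0 rewrite γ0 = refl
... | false | γ0 rewrite γ0 = refl
rotate-inverse β γ opp 2 with β 0 | opp 0
... | true  | γ0 rewrite γ0 = refl
... | false | γ0 rewrite γ0 = refl
rotate-inverse β γ opp (suc (suc (suc n))) =
  cong (3 +_) (rotate-inverse (β ∘ suc) (γ ∘ suc) (opp ∘ suc) n)

rotate-derangement : ∀ β → Derangement (rotate β)
rotate-derangement β = record
  { injective    = λ m n eq →
      trans (sym (rotate-inverse β (not ∘ β) (λ _ → refl) m))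
            (trans (cong (rotate (not ∘ β)) eq) (rotate-inverse β (not ∘ β) (λ _ → refl) n))
  ; surjective   = λ m → rotate (not ∘ β) m , rotate-inverse (not ∘ β) β (sym ∘ not-involutive ∘ β) m
  ; fixpointFree = fixpointFree β
  }
  where
  fixpointFree : ∀ β n → rotate β n ≢ n
  fixpointFree β 0 with β 0
  ... | true  = λ ()
  ... | false = λ ()
  fixpointFree β 1 with β 0
  ... | true  = λ ()
  ... | false = λ ()
  fixpointFree β 2 with β 0
  ... | true  = λ ()
  ... | false = λ ()
  fixpointFree β (suc (suc (suc n))) eq =
    fixpointFree (β ∘ suc) n (suc-injective (suc-injective (suc-injective eq)))

HasCard≤0⇒empty : ∀ {P : ℕ → Set} {c} → HasCard P c → c ≤c fin 0 → ∀ x → ¬ P x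
HasCard≤0⇒empty (_ , _ , _ , enumerates) (fin≤fin z≤n) x Px with enumerates x Px
... | () , _

rearrangement : ∀ {C : Set} {s w : Word C} {κ ρ ε} → IsFeedback s w (κ , ρ , ε) → ℕ → ℕ
rearrangement (_ , π , _) = π

module _ {C : Set} {s w : Word C} {τ : ℕ → ℕ}
         (s-injective : InjectiveWord s) (τ-derangement : Derangement τ)
         (w≗s∘τ : ∀ n → w n ≡ s (τ n)) where

  open Derangement τ-derangement

  deranged-incorrect : ∀ n → Incorrect s w n
  deranged-incorrect n correct = fixpointFree n (sym (s-injective _ _ (trans correct (w≗s∘τ n))))

  optimal-rearrangement : ∀ {κ ρ ε} (fb : IsFeedback s w (κ , ρ , ε)) → ∀ n → rearrangement fb n ≡ τ n
  optimal-rearrangement (_ , π , _ , _ , π-remaining , _ , ε-minimal) n =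
    decidable-stable (π n ≟ τ n) λ π≢τ →
      noneRemaining n (deranged-incorrect n , λ eq → π≢τ (s-injective _ _ (trans eq (w≗s∘τ n))))
    where
    τ-permutes : PermOn (Incorrect s w) τ
    τ-permutes = (λ n _ → deranged-incorrect (τ n))
               , (λ m n _ _ → injective m n)
               , (λ m _ → let n , τn≡m = surjective m in n , deranged-incorrect n , τn≡m)
    τ-remaining : HasCard (RemainingIncorrect s w τ) (fin 0)
    τ-remaining = (λ ()) , (λ ()) , (λ ()) , λ x (_ , wrong) → ⊥-elim (wrong (sym (w≗s∘τ x)))
    noneRemaining : ∀ x → ¬ RemainingIncorrect s w π x
    noneRemaining = HasCard≤0⇒empty π-remaining (ε-minimal τ (fin 0) τ-permutes τ-remaining)

module _ {C : Set} (σ : Strategy C) where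

  firstRearrangement : ∀ {w h} → Reachable σ w h → ℕ → ℕ
  firstRearrangement start                           = id  -- junk: no guess was made
  firstRearrangement (step {f = _ , _ , _} start fb) = rearrangement fb
  firstRearrangement (step r@(step _ _) _)           = firstRearrangement r

  module _ {w : Word C} {τ : ℕ → ℕ} (first-injective : InjectiveWord (σ []))
           (τ-derangement : Derangement τ) (w≗first∘τ : ∀ n → w n ≡ σ [] (τ n)) where

    firstRearrangement-of-win : ∀ {h} (r : Reachable σ w h) → (∀ n → σ h n ≡ w n) →
                                ∀ n → firstRearrangement r n ≡ τ n
    firstRearrangement-of-win start won =
      ⊥-elim (deranged-incorrect first-injective τ-derangement w≗first∘τ 0 (won 0))
    firstRearrangement-of-win (step r fb) _ = afterFirstGuess r fb
      where
      afterFirstGuess : ∀ {h f} (r : Reachable σ w h) (fb : IsFeedback (σ h) w f) →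
                        ∀ n → firstRearrangement (step r fb) n ≡ τ n
      afterFirstGuess {f = _ , _ , _} start fb =
        optimal-rearrangement first-injective τ-derangement w≗first∘τ fb
      afterFirstGuess (step r fb) _ = afterFirstGuess r fb

  injectiveCoding : (∀ h → InjectiveWord (σ h)) → (∀ w → InjectiveWord w → WinsAgainst σ w) →
                    BitCoding withoutDuplication σ
  injectiveCoding guess-injective wins = record
    { codeword     = codeword
    ; admissible   = λ β m n eq →
        Derangement.injective (rotate-derangement β) m n (guess-injective [] _ _ eq)
    ; decode       = decode
    ; decode-guess = decode-guess
    }
    where
    open ≡-Reasoning

    codeword : (ℕ → Bool) → Word C
    codeword β = σ [] ∘ rotate β

    winningPlay : ∀ h → Reachable σ (σ h) (proj₁ (wins (σ h) (guess-injective h)))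
    winningPlay h = proj₁ (proj₂ (wins (σ h) (guess-injective h)))

    decode : List Feedback → ℕ → Bool
    decode h i = firstRearrangement (winningPlay h) (blockStart i) ≡ᵇ suc (blockStart i)

    decode-guess : ∀ h β → (∀ n → σ h n ≡ codeword β n) → ∀ i → decode h i ≡ β i
    decode-guess h β guessed i = begin
      decode h i
        ≡⟨ cong (_≡ᵇ suc (blockStart i)) rearrangement≡rotation ⟩
      rotate β (blockStart i) ≡ᵇ suc (blockStart i)
        ≡⟨ rotate-bit β i ⟩
      β i
        ∎
      where
      rearrangement≡rotation :
        firstRearrangement (winningPlay h) (blockStart i) ≡ rotate β (blockStart i)
      rearrangement≡rotation =
        firstRearrangement-of-win (guess-injective []) (rotate-derangement β) guessed
          (winningPlay h) (proj₂ (proj₂ (wins (σ h) (guess-injective h)))) (blockStart i)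

mainTheorem9 : (C : Set) (a b : C) → a ≢ b → (v : Variant) →
    (∃ λ (w : Word C) → Admissible v w) →
    (σ : Strategy C) → (∀ h → Admissible v (σ h)) →
    ¬ (∀ (w : Word C) → Admissible v w → WinsAgainst σ w)
mainTheorem9 C a b a≢b withDuplication _ σ _ wins =
  BitCoding.notWinning (duplicationCoding σ a≢b (decidableColours σ λ c → wins (λ _ → c) tt)) wins
mainTheorem9 C a b a≢b withoutDuplication _ σ guess-injective wins =
  BitCoding.notWinning (injectiveCoding σ guess-injective wins) wins
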